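{- Let $m,n\geq 2$, let $G=(V,E)$ be the rook's graph $K_m\square K_n$ and let $\alpha$ be an elimination ordering over $G$. For every step $i\in\{1,\dots,|V|\}$, $$|\mathrm{madj}^+_\alpha(\alpha(i))| = nm-(m-|\mathcal{M}_\alpha(i)|)(n-|\mathcal{L}_\alpha(i)|)-|V_{\mathrm{comp}_\alpha(i)}|.$$
   Context: The rook's graph $K_m\square K_n$ has vertex set $\{v_{r,c}: 1\le r\le m, 1\le c\le n\}$, with $v_{r,c}\sim v_{r',c'}$ iff exactly one of $r=r'$, $c=c'$ holds. For a graph $G=(V,E)$, an elimination ordering is a bijection $\alpha:\{1,\dots,|V|\}\to V$. The elimination game: $G_0=G$, and for $i=1,\dots,|V|$, $G_i$ is obtained from $G_{i-1}$ by adding edges so that $N_{G_{i-1}}(\alpha(i))$ becomes a clique and then deleting $\alpha(i)$. Define $\mathrm{madj}^+_\alpha(\alpha(i)) := N_{G_{i-1}}(\alpha(i))$. For $i\le j$ let $\alpha[i,j]=\{\alpha(t): i\le t\le j\}$. Let $\mathrm{comp}_\alpha(i)$ be the connected component of $G[\alpha[1,i]]$ containing $\alpha(i)$, with vertex set $V_{\mathrm{comp}_\alpha(i)}$. Let $\mathcal{M}_\alpha(i)=\{r : \exists c,\ v_{r,c}\in V_{\mathrm{comp}_\alpha(i)}\}$ and $\mathcal{L}_\alpha(i)=\{c: \exists r,\ v_{r,c}\in V_{\mathrm{comp}_\alpha(i)}\}$. -}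

module Defs where

open import Data.Nat using (ℕ; _≤_; _*_)
open import Data.Bool using (Bool; true; false; _∧_; _∨_; not; _xor_; T)
open import Data.Fin using (Fin; toℕ)
open import Data.Fin.Properties using (_≟_)
open import Data.Product using (_×_; _,_; ∃)
open import Data.List using (List; []; _∷_; foldl; take; map; filter; length; allFin; cartesianProduct)
open import Relation.Nullary using (does)
open import Relation.Binary.PropositionalEquality using (_≡_)
open import Function.Definitions using (Bijective)

V : ℕ → ℕ → Set
V m n = Fin m × Fin n

_==V_ : ∀ {m n} → V m n → V m n → Bool
(r , c) ==V (r' , c') = does (r ≟ r') ∧ does (c ≟ c')

rookAdj : ∀ {m n} → V m n → V m n → Bool
rookAdj (r , c) (r' , c') = does (r ≟ r') xor does (c ≟ c')

allV : (m n : ℕ) → List (V m n)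
allV m n = cartesianProduct (allFin m) (allFin n)

-- Elimination orderings: bijections {1..|V|} → V (0-indexed as Fin (m * n))
record EliminationOrdering (m n : ℕ) : Set where
  field
    α : Fin (m * n) → V m n
    bij : Bijective _≡_ _≡_ α
open EliminationOrdering public

-- A graph on (a subset of) V is given by a Boolean edge relation;
-- removed vertices have no incident edges.
Graph : ℕ → ℕ → Set
Graph m n = V m n → V m n → Bool

-- One step of the elimination game: make N(w) a clique, then delete w.
eliminate : ∀ {m n} → Graph m n → V m n → Graph m n
eliminate E w u v =
  not (u ==V w) ∧ not (v ==V w) ∧ (E u v ∨ (not (u ==V v) ∧ E w u ∧ E w v))

gameGraph : ∀ {m n} → EliminationOrdering m n → ℕ → Graph m n
gameGraph {m} {n} o k =
  foldl eliminate rookAdj (take k (map (α o) (allFin (m * n))))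

-- madj⁺_α(α(i)) = N_{G_{i-1}}(α(i)); here i is 0-indexed, so G_{i-1} = gameGraph o (toℕ i)
madjPlus : ∀ {m n} → EliminationOrdering m n → Fin (m * n) → List (V m n)
madjPlus {m} {n} o i =
  filter (λ v → T? (gameGraph o (toℕ i) (α o i) v)) (allV m n)
  where
    open import Data.Bool using (T?)

-- v ∈ α[1,i] (0-indexed: v = α t with t ≤ i)
InPrefix : ∀ {m n} → EliminationOrdering m n → Fin (m * n) → V m n → Set
InPrefix o i v = ∃ λ t → toℕ t ≤ toℕ i × α o t ≡ v

data Reach {m n} (P : V m n → Set) (x : V m n) : V m n → Set where
  here : P x → Reach P x x
  step : ∀ {u v} → Reach P x u → T (rookAdj u v) → P v → Reach P x v

InComp : ∀ {m n} → EliminationOrdering m n → Fin (m * n) → V m n → Set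
InComp o i v = Reach (InPrefix o i) (α o i) v

InRows : ∀ {m n} → EliminationOrdering m n → Fin (m * n) → Fin m → Set
InRows o i r = ∃ λ c → InComp o i (r , c)

InCols : ∀ {m n} → EliminationOrdering m n → Fin (m * n) → Fin n → Set
InCols o i c = ∃ λ r → InComp o i (r , c)

{-# OPTIONS --safe #-}
-- By the fill-path lemma of Rose, Tarjan and Lueker, two uneliminated vertices are
-- adjacent in G_{i-1} iff the rook's graph joins them by a path whose interior was
-- eliminated before them. Hence the neighbours of α(i) are exactly the vertices outside
-- comp_α(i) that are adjacent to it, and in the rook's graph a vertex outside a set is
-- adjacent to the set iff its row or its column meets it. So madj⁺(α(i)) is the set of
-- cells on the rows M or the columns L, minus the component; the cells on none of these
-- lines form an (m − |M|) × (n − |L|) grid, and the component lies on these lines.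
module Submission where

open import Defs
open import Data.Nat using (ℕ; suc; _+_; _*_; _∸_; _≤_; _<_; s≤s; z≤n)
open import Data.Nat.Properties
  using (<⇒≤; ≤-refl; <-irrefl; m≤n⇒m<n∨m≡n; m+n∸m≡n; m+n∸n≡m; +-assoc; *-comm)
open import Data.Bool using (T; not; false; true)
open import Data.Bool.Properties using (T-∧; T-∨)
open import Data.Fin using (Fin; toℕ) renaming (zero to fzero; suc to fsuc)
open import Data.Fin.Properties as Fin using (toℕ-injective)
open import Data.Product using (_×_; _,_; proj₁; proj₂; ∃)
open import Data.Product.Properties using (≡-dec)
open import Data.Product.Function.NonDependent.Propositional using (_×-⇔_)
open import Data.Sum using (_⊎_; inj₁; inj₂; [_,_])
open import Data.Sum.Function.Propositional using (_⊎-⇔_)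
open import Data.List
  using (List; []; _∷_; length; filter; map; _++_; foldl; take; tabulate; allFin; cartesianProduct;
         reverse; reverseAcc)
open import Data.List.Properties using (length-++; length-map; length-tabulate; map-tabulate)
open import Data.List.Relation.Unary.Any using (here; there)
open import Data.List.Relation.Unary.Any.Properties using (reverse⁺; reverse⁻)
open import Data.List.Relation.Unary.Unique.Propositional using (Unique)
open import Data.List.Relation.Unary.Unique.Propositional.Properties
  using (++⁺; filter⁺; cartesianProduct⁺; allFin⁺)
open import Data.List.Membership.Propositional using (_∈_; _∉_)
open import Data.List.Membership.Propositional.Properties
  using (∈-++⁺ˡ; ∈-++⁺ʳ; ∈-++⁻; ∈-filter⁺; ∈-filter⁻; ∈-allFin; ∈-cartesianProduct⁺; ∈-cartesianProduct⁻)
open import Data.List.Membership.Propositional.Properties.WithK using (unique∧set⇒bag)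
import Data.List.Membership.DecPropositional as DecMembership
open import Data.List.Relation.Binary.BagAndSetEquality using (_∼[_]_; set; ∼bag⇒↭)
open import Data.List.Relation.Binary.Permutation.Propositional.Properties using (↭-length)
open import Data.List.Relation.Binary.Subset.Propositional using (_⊆_)
open import Function using (_∘_; id)
open import Function.Bundles using (_⇔_; mk⇔; Equivalence)
open import Function.Construct.Composition using (_⇔-∘_)
open import Function.Construct.Symmetry using (⇔-sym)
open import Function.Construct.Identity using (⇔-id)
open import Function.Related.TypeIsomorphisms using (¬-cong-⇔)
open import Relation.Binary.Definitions using (DecidableEquality)
open import Relation.Binary.PropositionalEquality
  using (_≡_; _≢_; refl; sym; trans; cong; cong₂; subst; module ≡-Reasoning)
open import Relation.Nullary using (Dec; ¬_; yes; no; contradiction)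
open import Relation.Nullary.Decidable using (_⊎-dec_)

open Equivalence using (to; from)

m+[n+o]≡p⇒m≡p∸o∸n : ∀ m n o {p} → m + (n + o) ≡ p → m ≡ p ∸ o ∸ n
m+[n+o]≡p⇒m≡p∸o∸n m n o {p} eq = begin
  m                 ≡⟨ m+n∸n≡m m n ⟨
  m + n ∸ n         ≡⟨ cong (_∸ n) (m+n∸n≡m (m + n) o) ⟨
  m + n + o ∸ o ∸ n ≡⟨ cong (λ k → k ∸ o ∸ n) (trans (+-assoc m n o) eq) ⟩
  p ∸ o ∸ n         ∎
  where open ≡-Reasoning

unique∧set⇒length≡ : {A : Set} {xs ys : List A} →
                     Unique xs → Unique ys → xs ∼[ set ] ys → length xs ≡ length ys
unique∧set⇒length≡ uxs uys xs≈ys = ↭-length (∼bag⇒↭ (unique∧set⇒bag uxs uys xs≈ys))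

length-cartesianProduct : {A B : Set} (xs : List A) (ys : List B) →
                          length (cartesianProduct xs ys) ≡ length xs * length ys
length-cartesianProduct []       ys = refl
length-cartesianProduct (x ∷ xs) ys =
  trans (length-++ (map (x ,_) ys)) (cong₂ _+_ (length-map (x ,_) ys) (length-cartesianProduct xs ys))

module _ {A : Set} (_≟_ : DecidableEquality A) where
  open DecMembership _≟_ using (_∈?_; _∉?_)

  length-filter-∉ : {xs ys : List A} → Unique xs → Unique ys → ys ⊆ xs →
                    length (filter (_∉? ys) xs) ≡ length xs ∸ length ys
  length-filter-∉ {xs} {ys} uxs uys ys⊆xs = begin
    length (filter (_∉? ys) xs)                         ≡⟨ m+n∸m≡n (length ys) _ ⟨
    length ys + length (filter (_∉? ys) xs) ∸ length ys ≡⟨ cong (_∸ length ys) (length-++ ys) ⟨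
    length (ys ++ filter (_∉? ys) xs) ∸ length ys       ≡⟨ cong (_∸ length ys) (unique∧set⇒length≡ u uxs split) ⟩
    length xs ∸ length ys                               ∎
    where
    open ≡-Reasoning
    u : Unique (ys ++ filter (_∉? ys) xs)
    u = ++⁺ uys (filter⁺ (_∉? ys) uxs)
            (λ (y∈ys , y∈rest) → proj₂ (∈-filter⁻ (_∉? ys) {xs = xs} y∈rest) y∈ys)
    split : (ys ++ filter (_∉? ys) xs) ∼[ set ] xs
    split {x} = mk⇔ ⊆xs cover
      where
      ⊆xs : x ∈ ys ++ filter (_∉? ys) xs → x ∈ xs
      ⊆xs x∈ with ∈-++⁻ ys x∈
      ... | inj₁ x∈ys   = ys⊆xs x∈ys
      ... | inj₂ x∈rest = proj₁ (∈-filter⁻ (_∉? ys) {xs = xs} x∈rest)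
      cover : x ∈ xs → x ∈ ys ++ filter (_∉? ys) xs
      cover x∈xs with x ∈? ys
      ... | yes x∈ys = ∈-++⁺ˡ x∈ys
      ... | no  x∉ys = ∈-++⁺ʳ ys (∈-filter⁺ (_∉? ys) x∈xs x∉ys)

module _ {k : ℕ} where
  open DecMembership (Fin._≟_ {k}) using (_∉?_)

  length-filter-∉-allFin : {L : List (Fin k)} → Unique L → length (filter (_∉? L) (allFin k)) ≡ k ∸ length L
  length-filter-∉-allFin {L} uL =
    trans (length-filter-∉ Fin._≟_ (allFin⁺ k) uL (λ {r} _ → ∈-allFin r))
          (cong (_∸ length L) (length-tabulate {n = k} id))

module _ {A : Set} where
  ∈-take-tabulate⁻ : ∀ {N} (f : Fin N → A) k {x} → x ∈ take k (tabulate f) → ∃ λ t → toℕ t < k × f t ≡ x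
  ∈-take-tabulate⁻ {suc N} f (suc k) (here refl) = fzero , s≤s z≤n , refl
  ∈-take-tabulate⁻ {suc N} f (suc k) (there x∈) with ∈-take-tabulate⁻ (f ∘ fsuc) k x∈
  ... | t , t<k , ft≡x = fsuc t , s≤s t<k , ft≡x

  ∈-take-tabulate⁺ : ∀ {N} (f : Fin N → A) {k} t → toℕ t < k → f t ∈ take k (tabulate f)
  ∈-take-tabulate⁺ f {suc k} fzero    _         = here refl
  ∈-take-tabulate⁺ f {suc k} (fsuc t) (s≤s t<k) = there (∈-take-tabulate⁺ (f ∘ fsuc) t t<k)

T-not : ∀ {b} → T (not b) ⇔ (¬ T b)
T-not {false} = mk⇔ (λ _ ()) _
T-not {true}  = mk⇔ (λ ()) (λ ¬t → ¬t _)

module _ {m n : ℕ} where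
  _≟V_ : DecidableEquality (V m n)
  _≟V_ = ≡-dec Fin._≟_ Fin._≟_

  T-==V : {u v : V m n} → T (u ==V v) ⇔ u ≡ v
  T-==V {r , c} {r′ , c′} with r Fin.≟ r′ | c Fin.≟ c′
  ... | yes refl | yes refl = mk⇔ (λ _ → refl) _
  ... | yes _    | no c≢c′  = mk⇔ (λ ()) (c≢c′ ∘ cong proj₂)
  ... | no r≢r′  | _        = mk⇔ (λ ()) (r≢r′ ∘ cong proj₁)

  T-not-==V : {u v : V m n} → T (not (u ==V v)) ⇔ (u ≢ v)
  T-not-==V = ¬-cong-⇔ T-==V ⇔-∘ T-not

  T-eliminate : {E : Graph m n} {w u v : V m n} →
                T (eliminate E w u v) ⇔ (u ≢ w × v ≢ w × (T (E u v) ⊎ u ≢ v × T (E w u) × T (E w v)))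
  T-eliminate =
    (T-not-==V ×-⇔ ((T-not-==V ×-⇔ ((⇔-id _ ⊎-⇔ ((T-not-==V ×-⇔ T-∧) ⇔-∘ T-∧)) ⇔-∘ T-∨)) ⇔-∘ T-∧)) ⇔-∘ T-∧

module FillPath {m n : ℕ} (E₀ : Graph m n)
                (E₀-sym : ∀ u v → T (E₀ u v) → T (E₀ v u))
                (E₀-irrefl : ∀ u → ¬ T (E₀ u u)) where

  open DecMembership (_≟V_ {m} {n}) using (_∈?_)

  data PathVia (S : V m n → Set) : V m n → V m n → Set where
    edge : ∀ {u v} → T (E₀ u v) → PathVia S u v
    cons : ∀ {u x v} → T (E₀ u x) → S x → PathVia S x v → PathVia S u v

  module _ {S : V m n → Set} where
    pathVia-snoc : ∀ {u x v} → PathVia S u x → S x → T (E₀ x v) → PathVia S u v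
    pathVia-snoc (edge e)      sx e′ = cons e sx (edge e′)
    pathVia-snoc (cons e sy p) sx e′ = cons e sy (pathVia-snoc p sx e′)

    pathVia-join : ∀ {u x v} → PathVia S u x → S x → PathVia S x v → PathVia S u v
    pathVia-join (edge e)      sx q = cons e sx q
    pathVia-join (cons e sy p) sx q = cons e sy (pathVia-join p sx q)

    pathVia-reverse : ∀ {u v} → PathVia S u v → PathVia S v u
    pathVia-reverse (edge e)      = edge (E₀-sym _ _ e)
    pathVia-reverse (cons e sx p) = pathVia-snoc (pathVia-reverse p) sx (E₀-sym _ _ e)

  pathVia-mono : ∀ {S S′ : V m n → Set} → (∀ {x} → S x → S′ x) → ∀ {u v} → PathVia S u v → PathVia S′ u v
  pathVia-mono S⊆S′ (edge e)      = edge e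
  pathVia-mono S⊆S′ (cons e sx p) = cons e (S⊆S′ sx) (pathVia-mono S⊆S′ p)

  pathVia-split : ∀ {w ds u v} → PathVia (_∈ w ∷ ds) u v →
                  PathVia (_∈ ds) u v ⊎ PathVia (_∈ ds) u w × PathVia (_∈ ds) w v
  pathVia-split (edge e) = inj₁ (edge e)
  pathVia-split (cons e (here refl) p) with pathVia-split p
  ... | inj₁ q        = inj₂ (edge e , q)
  ... | inj₂ (_ , q)  = inj₂ (edge e , q)
  pathVia-split (cons e (there x∈ds) p) with pathVia-split p
  ... | inj₁ q        = inj₁ (cons e x∈ds q)
  ... | inj₂ (q , q′) = inj₂ (cons e x∈ds q , q′)

  -- The fill-path lemma of Rose, Tarjan and Lueker, as an invariant of the elimination game.
  FillInvariant : Graph m n → List (V m n) → Set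
  FillInvariant E ds = ∀ {u v} → T (E u v) ⇔ (u ∉ ds × v ∉ ds × u ≢ v × PathVia (_∈ ds) u v)

  fillInvariant-[] : FillInvariant E₀ []
  fillInvariant-[] = mk⇔ (λ e → (λ ()) , (λ ()) , (λ { refl → E₀-irrefl _ e }) , edge e)
                         (λ { (_ , _ , _ , edge e) → e ; (_ , _ , _ , cons _ () _) })

  fillInvariant-eliminate : ∀ {E ds w} → FillInvariant E ds → FillInvariant (eliminate E w) (w ∷ ds)
  fillInvariant-eliminate {E} {ds} {w} inv {u} {v} = mk⇔ ⇒path path⇒ ⇔-∘ T-eliminate
    where
    ∉-∷ : ∀ {x} → x ≢ w → x ∉ ds → x ∉ w ∷ ds
    ∉-∷ x≢w x∉ds (here x≡w)   = x≢w x≡w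
    ∉-∷ x≢w x∉ds (there x∈ds) = x∉ds x∈ds
    ⇒path : u ≢ w × v ≢ w × (T (E u v) ⊎ u ≢ v × T (E w u) × T (E w v)) →
            u ∉ w ∷ ds × v ∉ w ∷ ds × u ≢ v × PathVia (_∈ w ∷ ds) u v
    ⇒path (u≢w , v≢w , inj₁ e) with to inv e
    ... | u∉ds , v∉ds , u≢v , p = ∉-∷ u≢w u∉ds , ∉-∷ v≢w v∉ds , u≢v , pathVia-mono there p
    ⇒path (u≢w , v≢w , inj₂ (u≢v , ewu , ewv)) with to inv ewu | to inv ewv
    ... | _ , u∉ds , _ , p | _ , v∉ds , _ , q =
      ∉-∷ u≢w u∉ds , ∉-∷ v≢w v∉ds , u≢v ,
      pathVia-join (pathVia-reverse (pathVia-mono there p)) (here refl) (pathVia-mono there q)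
    path⇒ : u ∉ w ∷ ds × v ∉ w ∷ ds × u ≢ v × PathVia (_∈ w ∷ ds) u v →
            u ≢ w × v ≢ w × (T (E u v) ⊎ u ≢ v × T (E w u) × T (E w v))
    path⇒ (u∉ , v∉ , u≢v , p) = u∉ ∘ here , v∉ ∘ here , through-w (pathVia-split p)
      where
      old : PathVia (_∈ ds) u v → T (E u v)
      old q = from inv (u∉ ∘ there , v∉ ∘ there , u≢v , q)
      through-w : PathVia (_∈ ds) u v ⊎ PathVia (_∈ ds) u w × PathVia (_∈ ds) w v →
                  T (E u v) ⊎ u ≢ v × T (E w u) × T (E w v)
      through-w (inj₁ q) = inj₁ (old q)
      through-w (inj₂ (q , q′)) with w ∈? ds
      ... | yes w∈ds = inj₁ (old (pathVia-join q w∈ds q′))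
      ... | no  w∉ds = inj₂ ( u≢v
                            , from inv (w∉ds , u∉ ∘ there , u∉ ∘ here ∘ sym , pathVia-reverse q)
                            , from inv (w∉ds , v∉ ∘ there , v∉ ∘ here ∘ sym , q′))

  fillInvariant-foldl : ∀ {E ds} → FillInvariant E ds →
                        ∀ ws → FillInvariant (foldl eliminate E ws) (reverseAcc ds ws)
  fillInvariant-foldl inv []       = inv
  fillInvariant-foldl inv (w ∷ ws) = fillInvariant-foldl (fillInvariant-eliminate inv) ws

module _ {m n : ℕ} where
  T-rookAdj : {r r′ : Fin m} {c c′ : Fin n} →
              T (rookAdj (r , c) (r′ , c′)) ⇔ (r ≡ r′ × c ≢ c′ ⊎ r ≢ r′ × c ≡ c′)
  T-rookAdj {r} {r′} {c} {c′} with r Fin.≟ r′ | c Fin.≟ c′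
  ... | yes r≡r′ | yes c≡c′ = mk⇔ (λ ()) [ (λ (_ , c≢c′) → c≢c′ c≡c′) , (λ (r≢r′ , _) → r≢r′ r≡r′) ]
  ... | yes r≡r′ | no c≢c′  = mk⇔ (λ _ → inj₁ (r≡r′ , c≢c′)) _
  ... | no r≢r′  | yes c≡c′ = mk⇔ (λ _ → inj₂ (r≢r′ , c≡c′)) _
  ... | no r≢r′  | no c≢c′  = mk⇔ (λ ()) [ (λ (r≡r′ , _) → r≢r′ r≡r′) , (λ (_ , c≡c′) → c≢c′ c≡c′) ]

  rookAdj-sym : (u v : V m n) → T (rookAdj u v) → T (rookAdj v u)
  rookAdj-sym (r , c) (r′ , c′) a = from (T-rookAdj {r′} {r} {c′} {c}) (swap (to (T-rookAdj {r} {r′} {c} {c′}) a))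
    where
    swap : r ≡ r′ × c ≢ c′ ⊎ r ≢ r′ × c ≡ c′ → r′ ≡ r × c′ ≢ c ⊎ r′ ≢ r × c′ ≡ c
    swap (inj₁ (r≡r′ , c≢c′)) = inj₁ (sym r≡r′ , c≢c′ ∘ sym)
    swap (inj₂ (r≢r′ , c≡c′)) = inj₂ (r≢r′ ∘ sym , sym c≡c′)

  rookAdj-irrefl : (u : V m n) → ¬ T (rookAdj u u)
  rookAdj-irrefl (r , c) a with to (T-rookAdj {r} {r} {c} {c}) a
  ... | inj₁ (_ , c≢c) = c≢c refl
  ... | inj₂ (r≢r , _) = r≢r refl

  allV-unique : Unique (allV m n)
  allV-unique = cartesianProduct⁺ (allFin⁺ m) (allFin⁺ n)

  ∈-allV : (v : V m n) → v ∈ allV m n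
  ∈-allV (r , c) = ∈-cartesianProduct⁺ (∈-allFin r) (∈-allFin c)

  length-allV : length (allV m n) ≡ m * n
  length-allV = trans (length-cartesianProduct (allFin m) (allFin n))
                      (cong₂ _*_ (length-tabulate {n = m} id) (length-tabulate {n = n} id))

  open FillPath (rookAdj {m} {n}) rookAdj-sym rookAdj-irrefl

  reach-end : ∀ {P : V m n → Set} {x y} → Reach P x y → P y
  reach-end (here px)     = px
  reach-end (step _ _ py) = py

  module _ {P S : V m n → Set} {w : V m n} where
    reach-lastEdge : (∀ {x} → S x → P x) → ∀ {x v} → Reach P w x → PathVia S x v →
                     ∃ λ z → Reach P w z × T (rookAdj z v)
    reach-lastEdge S⊆P r (edge e)      = _ , r , e
    reach-lastEdge S⊆P r (cons e sx p) = reach-lastEdge S⊆P (step r e (S⊆P sx)) p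

    reach-pathVia : (∀ {x} → P x → x ≡ w ⊎ S x) → ∀ {z v} → Reach P w z → T (rookAdj z v) → PathVia S w v
    reach-pathVia P⊆ (here _)       e = edge e
    reach-pathVia P⊆ (step r e′ pz) e with P⊆ pz
    ... | inj₁ refl = edge e
    ... | inj₂ sz   = pathVia-snoc (reach-pathVia P⊆ r e′) sz e

  neighbours-of-component : ∀ {E ds} {P : V m n → Set} {w} → FillInvariant E ds →
                            (∀ {x} → P x ⇔ (x ≡ w ⊎ x ∈ ds)) → w ∉ ds →
                            ∀ {v} → T (E w v) ⇔ (¬ Reach P w v × ∃ λ z → Reach P w z × T (rookAdj z v))
  neighbours-of-component {E} {ds} {P} {w} inv P⇔ w∉ds {v} = mk⇔ ⇒boundary boundary⇒
    where
    ds⊆P : ∀ {x} → x ∈ ds → P x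
    ds⊆P = from P⇔ ∘ inj₂
    Pw : P w
    Pw = from P⇔ (inj₁ refl)
    ⇒boundary : T (E w v) → ¬ Reach P w v × ∃ λ z → Reach P w z × T (rookAdj z v)
    ⇒boundary e with to inv e
    ... | _ , v∉ds , w≢v , p = outside , reach-lastEdge ds⊆P (here Pw) p
      where
      outside : ¬ Reach P w v
      outside r with to P⇔ (reach-end r)
      ... | inj₁ v≡w  = w≢v (sym v≡w)
      ... | inj₂ v∈ds = v∉ds v∈ds
    boundary⇒ : ¬ Reach P w v × (∃ λ z → Reach P w z × T (rookAdj z v)) → T (E w v)
    boundary⇒ (outside , z , r , e) =
      from inv (w∉ds , outside ∘ step r e ∘ ds⊆P , (λ { refl → outside (here Pw) }) , reach-pathVia (to P⇔) r e)

  adjacent⇔sharesLine : {K : V m n → Set} {r : Fin m} {c : Fin n} → ¬ K (r , c) →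
                        (∃ λ z → K z × T (rookAdj z (r , c))) ⇔ ((∃ λ c′ → K (r , c′)) ⊎ (∃ λ r′ → K (r′ , c)))
  adjacent⇔sharesLine {K} {r} {c} ¬Krc = mk⇔ ⇒line line⇒
    where
    ⇒line : (∃ λ z → K z × T (rookAdj z (r , c))) → (∃ λ c′ → K (r , c′)) ⊎ (∃ λ r′ → K (r′ , c))
    ⇒line ((r′ , c′) , k , e) with to (T-rookAdj {r′} {r} {c′} {c}) e
    ... | inj₁ (refl , _) = inj₁ (c′ , k)
    ... | inj₂ (_ , refl) = inj₂ (r′ , k)
    line⇒ : (∃ λ c′ → K (r , c′)) ⊎ (∃ λ r′ → K (r′ , c)) → ∃ λ z → K z × T (rookAdj z (r , c))
    line⇒ (inj₁ (c′ , k)) with c′ Fin.≟ c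
    ... | yes refl = contradiction k ¬Krc
    ... | no  c′≢c = (r , c′) , k , from (T-rookAdj {r} {r} {c′} {c}) (inj₁ (refl , c′≢c))
    line⇒ (inj₂ (r′ , k)) with r′ Fin.≟ r
    ... | yes refl = contradiction k ¬Krc
    ... | no  r′≢r = (r′ , c) , k , from (T-rookAdj {r′} {r} {c} {c}) (inj₂ (r′≢r , refl))

module _ {m n : ℕ} (o : EliminationOrdering m n) (i : Fin (m * n)) where
  open FillPath (rookAdj {m} {n}) rookAdj-sym rookAdj-irrefl

  eliminatedBefore : List (V m n)
  eliminatedBefore = take (toℕ i) (map (α o) (allFin (m * n)))

  ∈-eliminatedBefore⁻ : ∀ {x} → x ∈ reverse eliminatedBefore → ∃ λ t → toℕ t < toℕ i × α o t ≡ x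
  ∈-eliminatedBefore⁻ x∈ =
    ∈-take-tabulate⁻ (α o) (toℕ i) (subst (λ xs → _ ∈ take (toℕ i) xs) (map-tabulate id (α o)) (reverse⁻ x∈))

  ∈-eliminatedBefore⁺ : ∀ {t} → toℕ t < toℕ i → α o t ∈ reverse eliminatedBefore
  ∈-eliminatedBefore⁺ {t} t<i =
    reverse⁺ (subst (λ xs → α o t ∈ take (toℕ i) xs) (sym (map-tabulate id (α o))) (∈-take-tabulate⁺ (α o) t t<i))

  α∉eliminatedBefore : α o i ∉ reverse eliminatedBefore
  α∉eliminatedBefore αi∈ with ∈-eliminatedBefore⁻ αi∈
  ... | t , t<i , αt≡αi = <-irrefl (cong toℕ (proj₁ (bij o) αt≡αi)) t<i

  inPrefix⇔ : ∀ {x} → InPrefix o i x ⇔ (x ≡ α o i ⊎ x ∈ reverse eliminatedBefore)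
  inPrefix⇔ = mk⇔ ⇒eliminated eliminated⇒
    where
    ⇒eliminated : ∀ {x} → InPrefix o i x → x ≡ α o i ⊎ x ∈ reverse eliminatedBefore
    ⇒eliminated (t , t≤i , refl) with m≤n⇒m<n∨m≡n t≤i
    ... | inj₁ t<i = inj₂ (∈-eliminatedBefore⁺ t<i)
    ... | inj₂ t≡i = inj₁ (cong (α o) (toℕ-injective t≡i))
    eliminated⇒ : ∀ {x} → x ≡ α o i ⊎ x ∈ reverse eliminatedBefore → InPrefix o i x
    eliminated⇒ (inj₁ refl) = i , ≤-refl , refl
    eliminated⇒ (inj₂ x∈) with ∈-eliminatedBefore⁻ x∈
    ... | t , t<i , αt≡x = t , <⇒≤ t<i , αt≡x

  ∈-madjPlus⇔ : ∀ {v} → v ∈ madjPlus o i ⇔ ((InRows o i (proj₁ v) ⊎ InCols o i (proj₂ v)) × ¬ InComp o i v)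
  ∈-madjPlus⇔ {v@(r , c)} = mk⇔ ⇒lines lines⇒ ⇔-∘ (neighbours ⇔-∘ ∈-filter-allV)
    where
    ∈-filter-allV : v ∈ madjPlus o i ⇔ T (gameGraph o (toℕ i) (α o i) v)
    ∈-filter-allV = mk⇔ (proj₂ ∘ ∈-filter⁻ _ {xs = allV m n}) (∈-filter⁺ _ (∈-allV v))
    neighbours : T (gameGraph o (toℕ i) (α o i) v) ⇔ (¬ InComp o i v × ∃ λ z → InComp o i z × T (rookAdj z v))
    neighbours =
      neighbours-of-component (fillInvariant-foldl fillInvariant-[] eliminatedBefore) inPrefix⇔ α∉eliminatedBefore
    ⇒lines : ¬ InComp o i v × (∃ λ z → InComp o i z × T (rookAdj z v)) →
             (InRows o i r ⊎ InCols o i c) × ¬ InComp o i v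
    ⇒lines (outside , adjacent) = to (adjacent⇔sharesLine outside) adjacent , outside
    lines⇒ : (InRows o i r ⊎ InCols o i c) × ¬ InComp o i v →
             ¬ InComp o i v × (∃ λ z → InComp o i z × T (rookAdj z v))
    lines⇒ (lines , outside) = outside , from (adjacent⇔sharesLine outside) lines

module _ {m n : ℕ} where
  open DecMembership (Fin._≟_ {m}) using () renaming (_∈?_ to _∈R?_; _∉?_ to _∉R?_)
  open DecMembership (Fin._≟_ {n}) using () renaming (_∈?_ to _∈C?_; _∉?_ to _∉C?_)
  open DecMembership (_≟V_ {m} {n}) using () renaming (_∈?_ to _∈V?_)

  OnLines : List (Fin m) → List (Fin n) → V m n → Set
  OnLines R C (r , c) = r ∈ R ⊎ c ∈ C

  length-onLines∖ : {R : List (Fin m)} {C : List (Fin n)} {K xs : List (V m n)} →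
                    Unique R → Unique C → Unique K → Unique xs →
                    (∀ {v} → v ∈ K → OnLines R C v) →
                    (∀ {v} → v ∈ xs ⇔ (OnLines R C v × v ∉ K)) →
                    length xs ≡ m * n ∸ (m ∸ length R) * (n ∸ length C) ∸ length K
  length-onLines∖ {R} {C} {K} {xs} uR uC uK uxs K⊆lines xs⇔ =
    m+[n+o]≡p⇒m≡p∸o∸n (length xs) (length K) ((m ∸ length R) * (n ∸ length C)) (begin
      length xs + (length K + (m ∸ length R) * (n ∸ length C)) ≡⟨ cong (λ k → length xs + (length K + k)) length-offLines ⟨
      length xs + (length K + length offLines)                 ≡⟨ cong (length xs +_) (length-++ K) ⟨
      length xs + length (K ++ offLines)                       ≡⟨ length-++ xs ⟨
      length (xs ++ K ++ offLines)                             ≡⟨ unique∧set⇒length≡ partition-unique (allV-unique {m} {n}) partition ⟩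
      length (allV m n)                                        ≡⟨ length-allV {m} {n} ⟩
      m * n                                                    ∎)
    where
    open ≡-Reasoning
    offRows : List (Fin m)
    offRows = filter (_∉R? R) (allFin m)
    offCols : List (Fin n)
    offCols = filter (_∉C? C) (allFin n)
    offLines : List (V m n)
    offLines = cartesianProduct offRows offCols

    ∈-offLines⇔ : ∀ {v} → v ∈ offLines ⇔ (¬ OnLines R C v)
    ∈-offLines⇔ {r , c} = mk⇔ ⇒off off⇒
      where
      ⇒off : (r , c) ∈ offLines → ¬ OnLines R C (r , c)
      ⇒off rc∈ with ∈-cartesianProduct⁻ offRows offCols rc∈
      ... | r∈ , c∈ = [ proj₂ (∈-filter⁻ (_∉R? R) {xs = allFin m} r∈)
                      , proj₂ (∈-filter⁻ (_∉C? C) {xs = allFin n} c∈) ]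
      off⇒ : ¬ OnLines R C (r , c) → (r , c) ∈ offLines
      off⇒ ¬lines = ∈-cartesianProduct⁺ (∈-filter⁺ (_∉R? R) (∈-allFin r) (¬lines ∘ inj₁))
                                         (∈-filter⁺ (_∉C? C) (∈-allFin c) (¬lines ∘ inj₂))

    length-offLines : length offLines ≡ (m ∸ length R) * (n ∸ length C)
    length-offLines = trans (length-cartesianProduct offRows offCols)
                            (cong₂ _*_ (length-filter-∉-allFin uR) (length-filter-∉-allFin uC))

    partition-unique : Unique (xs ++ K ++ offLines)
    partition-unique =
      ++⁺ uxs (++⁺ uK (cartesianProduct⁺ (filter⁺ (_∉R? R) (allFin⁺ m)) (filter⁺ (_∉C? C) (allFin⁺ n)))
                   (λ (v∈K , v∈off) → to ∈-offLines⇔ v∈off (K⊆lines v∈K)))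
              (λ (v∈xs , v∈rest) → disjoint (to xs⇔ v∈xs) (∈-++⁻ K v∈rest))
      where
      disjoint : ∀ {v} → OnLines R C v × v ∉ K → ¬ (v ∈ K ⊎ v ∈ offLines)
      disjoint (_     , v∉K) (inj₁ v∈K)   = v∉K v∈K
      disjoint (lines , _)   (inj₂ v∈off) = to ∈-offLines⇔ v∈off lines

    partition : (xs ++ K ++ offLines) ∼[ set ] allV m n
    partition {v@(r , c)} = mk⇔ (λ _ → ∈-allV v) (λ _ → cover (v ∈V? K) (r ∈R? R ⊎-dec c ∈C? C))
      where
      cover : Dec (v ∈ K) → Dec (OnLines R C v) → v ∈ xs ++ K ++ offLines
      cover (yes v∈K) _           = ∈-++⁺ʳ xs (∈-++⁺ˡ v∈K)
      cover (no v∉K)  (yes lines) = ∈-++⁺ˡ (from xs⇔ (lines , v∉K))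
      cover (no _)    (no ¬lines) = ∈-++⁺ʳ xs (∈-++⁺ʳ K (from ∈-offLines⇔ ¬lines))

mainTheorem3 : (m n : ℕ) → 2 ≤ m → 2 ≤ n → (o : EliminationOrdering m n) → (i : Fin (m * n))
    → (compL : List (V m n)) → Unique compL → (∀ v → (v ∈ compL) ⇔ InComp o i v)
    → (rowL : List (Fin m)) → Unique rowL → (∀ r → (r ∈ rowL) ⇔ InRows o i r)
    → (colL : List (Fin n)) → Unique colL → (∀ c → (c ∈ colL) ⇔ InCols o i c)
    → length (madjPlus o i)
      ≡ n * m ∸ (m ∸ length rowL) * (n ∸ length colL) ∸ length compL
mainTheorem3 m n _ _ o i compL uK K⇔ rowL uR R⇔ colL uC C⇔ =
  subst (λ k → length (madjPlus o i) ≡ k ∸ (m ∸ length rowL) * (n ∸ length colL) ∸ length compL)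
        (*-comm m n)
        (length-onLines∖ uR uC uK (filter⁺ _ allV-unique) comp⊆lines ∈-madjPlus⇔lists)
  where
  comp⊆lines : ∀ {v} → v ∈ compL → OnLines rowL colL v
  comp⊆lines {r , c} v∈ = inj₁ (from (R⇔ r) (c , to (K⇔ (r , c)) v∈))
  ∈-madjPlus⇔lists : ∀ {v} → v ∈ madjPlus o i ⇔ (OnLines rowL colL v × v ∉ compL)
  ∈-madjPlus⇔lists {r , c} =
    ((⇔-sym (R⇔ r) ⊎-⇔ ⇔-sym (C⇔ c)) ×-⇔ ¬-cong-⇔ (⇔-sym (K⇔ (r , c)))) ⇔-∘ ∈-madjPlus⇔ o i
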